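{- Let $k\ge2$ and let $G$ be a strong $k$-chromatic-choosable graph with $n$ vertices and $e$ edges such that $d=e-n(k-2)>0$. If $p$ is a positive integer with $d\le p(2k+p-3)/2$, then $G\vee K_p$ is a strong $(k+p)$-chromatic-choosable graph satisfying $|E(G\vee K_p)|\le |V(G\vee K_p)|(k+p-2)$.
   Context: A list assignment gives each vertex a color set; a $k$-assignment has all lists of size $k$; $G$ is $L$-colorable if it has a proper coloring choosing each vertex's color from its list. A list assignment is constant if all lists are equal. $G$ is strong $k$-chromatic-choosable if $\chi(G)=k$ and every $(k-1)$-assignment $L$ for which $G$ is not $L$-colorable is constant. $\vee$ denotes the join. -}

module Defs where

open import Data.Nat using (ℕ; _<_; _<ᵇ_; _∸_)
open import Data.Bool using (Bool; true; false; if_then_else_; _∧_; not)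
open import Data.Fin using (Fin; toℕ; splitAt; _≟_)
open import Data.Sum using (_⊎_; inj₁; inj₂)
open import Data.List using (List; length; map; allFin)
open import Data.Nat.ListAction using (sum)
import Data.Empty
open import Relation.Binary.PropositionalEquality using (refl)
open import Relation.Nullary using (yes; no)
open import Data.List.Membership.Propositional using (_∈_)
open import Data.List.Relation.Unary.Unique.Propositional using (Unique)
open import Data.Product using (_×_; ∃)
open import Relation.Binary.PropositionalEquality using (_≡_; _≢_)
open import Relation.Nullary using (¬_; does)
open import Function.Bundles using (_⇔_)

record Graph (n : ℕ) : Set where
  field
    adj    : Fin n → Fin n → Bool
    sym    : ∀ i j → adj i j ≡ adj j i
    irrefl : ∀ i → adj i i ≡ false
open Graph public

edgeCount : ∀ {n} → Graph n → ℕ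
edgeCount {n} G =
  sum (map (λ i → sum (map (λ j → if (toℕ i <ᵇ toℕ j) ∧ adj G i j then 1 else 0) (allFin n))) (allFin n))

Colorable : ∀ {n} → Graph n → ℕ → Set
Colorable {n} G k = ∃ λ (c : Fin n → Fin k) → ∀ u v → adj G u v ≡ true → c u ≢ c v

ChromaticNumber : ∀ {n} → Graph n → ℕ → Set
ChromaticNumber G k = Colorable G k × (∀ m → m < k → ¬ Colorable G m)

-- List assignments: each vertex gets a finite set of colours (a duplicate-free list of naturals).
ListAssignment : ℕ → Set
ListAssignment n = Fin n → List ℕ

IsAssignment : ∀ {n} → ListAssignment n → ℕ → Set
IsAssignment {n} L k = ∀ v → Unique (L v) × length (L v) ≡ k

LColorable : ∀ {n} → Graph n → ListAssignment n → Set
LColorable {n} G L =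
  ∃ λ (f : Fin n → ℕ) → (∀ v → f v ∈ L v) × (∀ u v → adj G u v ≡ true → f u ≢ f v)

Constant : ∀ {n} → ListAssignment n → Set
Constant {n} L = ∀ (u v : Fin n) (c : ℕ) → (c ∈ L u) ⇔ (c ∈ L v)

StrongChromaticChoosable : ∀ {n} → Graph n → ℕ → Set
StrongChromaticChoosable {n} G k =
  ChromaticNumber G k ×
  (∀ (L : ListAssignment n) → IsAssignment L (k ∸ 1) → ¬ LColorable G L → Constant L)

-- Join G ∨ K_p : vertices Fin (n + p); first n are G, last p form a clique,
-- and every vertex of G is adjacent to every vertex of K_p.
joinAdj : ∀ {n} p → Graph n → Fin (Data.Nat._+_ n p) → Fin (Data.Nat._+_ n p) → Bool
joinAdj {n} p G x y with splitAt n x | splitAt n y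
... | inj₁ i | inj₁ j = adj G i j
... | inj₁ _ | inj₂ _ = true
... | inj₂ _ | inj₁ _ = true
... | inj₂ i | inj₂ j = not (does (i ≟ j))

joinSym : ∀ {n} p (G : Graph n) x y → joinAdj p G x y ≡ joinAdj p G y x
joinSym {n} p G x y with splitAt n x | splitAt n y
... | inj₁ i | inj₁ j = Graph.sym G i j
... | inj₁ _ | inj₂ _ = refl
... | inj₂ _ | inj₁ _ = refl
... | inj₂ i | inj₂ j with i ≟ j | j ≟ i
... | yes _ | yes _ = refl
... | no _ | no _ = refl
... | yes e | no ne = Data.Empty.⊥-elim (ne (Relation.Binary.PropositionalEquality.sym e))
... | no ne | yes e = Data.Empty.⊥-elim (ne (Relation.Binary.PropositionalEquality.sym e))

joinIrrefl : ∀ {n} p (G : Graph n) x → joinAdj p G x x ≡ false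
joinIrrefl {n} p G x with splitAt n x
... | inj₁ i = irrefl G i
... | inj₂ i with i ≟ i
... | yes _ = refl
... | no ne = Data.Empty.⊥-elim (ne refl)

_∨K_ : ∀ {n} → Graph n → (p : ℕ) → Graph (Data.Nat._+_ n p)
G ∨K p = record { adj = joinAdj p G ; sym = joinSym p G ; irrefl = joinIrrefl p G }

module Submission where

-- Adding a universal vertex w to a strong k-chromatic-choosable graph H′ (k ≥ 2) gives a strong
-- (k+1)-chromatic-choosable graph, and G ∨ K_p is obtained from G by adding p universal vertices.
-- For the list property, let L be a k-assignment of H′ + w with no L-colouring and c ∈ L(w).
-- Colouring w with c and deleting from each other list c (when present) or some chosen colour
-- leaves a non-colourable (k−1)-assignment of H′, which is therefore constant. Varying the chosen
-- colour at a vertex u₀ whose list misses c gives a contradiction, so L(w) ⊆ L(u) for every u,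
-- and equality follows since all lists have k elements.
-- The edge count is |E(G)| + np + C(p,2), and the size bound is a rearrangement of the hypothesis on d.

open import Defs hiding (sym)
open import Data.Bool using (true; false; not; _∧_; if_then_else_)
open import Data.Bool.Properties using (∧-identityʳ) renaming (_≟_ to _≟ᵇ_)
open import Data.Fin as Fin using (Fin; zero; suc; toℕ; punchOut; _↑ˡ_; _↑ʳ_; splitAt)
open import Data.Fin.Properties
  using (punchOut-injective; any?; splitAt-↑ˡ; splitAt-↑ʳ; join-splitAt; toℕ-↑ˡ; toℕ-↑ʳ)
  renaming (suc-injective to Fin-suc-injective)
open import Data.List using (List; []; _∷_; length; filter; map; allFin; tabulate)
open import Data.List.Properties using (filter-all; map-tabulate)
open import Data.List.Membership.Propositional using (_∈_; _∉_)
open import Data.List.Membership.Propositional.Properties using (∈-filter⁺; ∈-filter⁻)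
open import Data.List.Relation.Unary.Any using (here; there)
open import Data.List.Relation.Unary.All using (lookup; _∷_)
open import Data.List.Relation.Unary.AllPairs using (_∷_)
open import Data.List.Relation.Unary.Unique.Propositional using (Unique)
open import Data.List.Relation.Binary.Subset.Propositional using (_⊆_)
open import Data.List.Relation.Unary.Unique.Propositional.Properties using (filter⁺)
open import Data.Nat as ℕ using (ℕ; zero; suc; _+_; _*_; _∸_; _≤_; _<_; _<ᵇ_; s≤s; z≤n; s≤s⁻¹)
open import Data.List.Membership.DecPropositional ℕ._≟_ using (_∈?_)
open import Data.Nat.Properties
  using (suc-injective; ≤-reflexive; <⇒≤; +-suc; +-comm; +-assoc; *-zeroʳ; *-identityʳ;
         +-0-commutativeMonoid; m∸n+n≡m; m+n∸n≡m; +-monoˡ-≤; +-cancelʳ-≤; *-cancelˡ-≤)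
import Data.Nat.ListAction as List
open import Algebra.Properties.CommutativeMonoid.Sum +-0-commutativeMonoid
  using (sum; sum-cong-≗; ∑-distrib-+; sum-syntax)
open import Data.Nat.Combinatorics using (_C_; nC1≡n; nCk+nC[k+1]≡[n+1]C[k+1])
open import Data.Nat.Tactic.RingSolver using (solve-∀)
open import Data.Product using (_×_; _,_; proj₁; proj₂; ∃; ∃₂)
open import Data.Sum using (_⊎_; inj₁; inj₂)
open import Function using (_∘_)
open import Function.Bundles using (_⇔_; mk⇔; Equivalence)
import Function.Properties.Equivalence as ⇔
open import Relation.Binary.Definitions using (DecidableEquality)
open import Relation.Binary.PropositionalEquality using (_≡_; _≢_; refl; sym; trans; cong; cong₂; subst; module ≡-Reasoning)
open import Relation.Nullary using (¬_; ¬?; yes; no; does; contradiction)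

module Deletion {A : Set} (_≟_ : DecidableEquality A) where

  delete : A → List A → List A
  delete x = filter (λ y → ¬? (x ≟ y))

  ∈-delete⁺ : ∀ {x y xs} → y ∈ xs → x ≢ y → y ∈ delete x xs
  ∈-delete⁺ = ∈-filter⁺ (λ y → ¬? (_ ≟ y))

  ∈-delete⁻ : ∀ {x y} xs → y ∈ delete x xs → y ∈ xs
  ∈-delete⁻ xs y∈ = proj₁ (∈-filter⁻ (λ y → ¬? (_ ≟ y)) {xs = xs} y∈)

  ∉-delete : ∀ x xs → x ∉ delete x xs
  ∉-delete x xs x∈ = proj₂ (∈-filter⁻ (λ y → ¬? (x ≟ y)) {xs = xs} x∈) refl

  delete-unique : ∀ x {xs} → Unique xs → Unique (delete x xs)
  delete-unique x = filter⁺ (λ y → ¬? (x ≟ y))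

  length-delete : ∀ {x xs} → Unique xs → x ∈ xs → suc (length (delete x xs)) ≡ length xs
  length-delete {x} {y ∷ xs} (y∉xs ∷ _) x∈ with x ≟ y
  ... | yes refl = cong (suc ∘ length) (filter-all (λ z → ¬? (x ≟ z)) y∉xs)
  length-delete _       (here x≡y)   | no x≢y = contradiction x≡y x≢y
  length-delete (_ ∷ u) (there x∈xs) | no _   = cong suc (length-delete u x∈xs)

  ⊆∧length≤⇒⊇ : ∀ {xs ys} → Unique xs → Unique ys → xs ⊆ ys → length ys ≤ length xs → ys ⊆ xs
  ⊆∧length≤⇒⊇ {[]} {[]} _ _ _ _ ()
  ⊆∧length≤⇒⊇ {x ∷ xs} {ys} (x∉xs ∷ uxs) uys xs⊆ys ys≤ {z} z∈ with z ≟ x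
  ... | yes z≡x = here z≡x
  ... | no z≢x  = there (⊆∧length≤⇒⊇ uxs (delete-unique x uys) xs⊆ys′ ys′≤ (∈-delete⁺ z∈ (z≢x ∘ sym)))
    where
    xs⊆ys′ : xs ⊆ delete x ys
    xs⊆ys′ w∈ = ∈-delete⁺ (xs⊆ys (there w∈)) (lookup x∉xs w∈)
    ys′≤ : length (delete x ys) ≤ length xs
    ys′≤ = s≤s⁻¹ (subst (_≤ suc (length xs)) (sym (length-delete uys (xs⊆ys (here refl)))) ys≤)

  ∈-nonempty : ∀ (xs : List A) {k} → length xs ≡ suc k → ∃ (_∈ xs)
  ∈-nonempty (x ∷ _) _ = x , here refl

  two-distinct : ∀ {xs : List A} {k} → Unique xs → length xs ≡ suc (suc k) →
                 ∃₂ λ a b → a ∈ xs × b ∈ xs × a ≢ b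
  two-distinct {a ∷ b ∷ _} ((a≢b ∷ _) ∷ _) _ = a , b , here refl , there (here refl) , a≢b

open Deletion ℕ._≟_

adj-irrefl : ∀ {n} (G : Graph n) {u v} → adj G u v ≡ true → u ≢ v
adj-irrefl G {u} a refl with () ← trans (sym (irrefl G u)) a

¬colorable-0 : ∀ {n} (G : Graph n) → Fin n → ¬ Colorable G 0
¬colorable-0 G v (c , _) with () ← c v

chromatic≥2⇒edge : ∀ {n k} (G : Graph n) → 2 ≤ k → ChromaticNumber G k →
                   ∃₂ λ u v → adj G u v ≡ true
chromatic≥2⇒edge G 2≤k (_ , minimal) with any? (λ u → any? (λ v → adj G u v ≟ᵇ true))
... | yes edge = edge
... | no noEdge = contradiction ((λ _ → zero) , λ u v a _ → noEdge (u , v , a)) (minimal 1 2≤k)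

other-than : ∀ {n} {u v : Fin n} → u ≢ v → ∀ w → ∃ (_≢ w)
other-than {u = u} {v} u≢v w with w Fin.≟ u
... | yes refl = v , u≢v ∘ sym
... | no w≢u   = u , w≢u ∘ sym

record ApexExtension {m n} (H′ : Graph m) (H : Graph n) : Set where
  field
    embed     : Fin m → Fin n
    apex      : Fin n
    embed-adj : ∀ u v → adj H (embed u) (embed v) ≡ adj H′ u v
    apex-adj  : ∀ u → adj H (embed u) apex ≡ true
    cover     : ∀ x → x ≡ apex ⊎ ∃ λ u → embed u ≡ x

module _ {m n} {H′ : Graph m} {H : Graph n} (ext : ApexExtension H′ H) where
  open ApexExtension ext

  apex-colorable : ∀ {k} → Colorable H′ k → Colorable H (suc k)
  apex-colorable (c′ , proper′) = c , proper
    where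
    c : Fin n → Fin _
    c x with cover x
    ... | inj₁ _       = zero
    ... | inj₂ (u , _) = suc (c′ u)
    proper : ∀ x y → adj H x y ≡ true → c x ≢ c y
    proper x y a with cover x | cover y
    ... | inj₁ refl       | inj₁ refl       = contradiction refl (adj-irrefl H a)
    ... | inj₁ _          | inj₂ _          = λ ()
    ... | inj₂ _          | inj₁ _          = λ ()
    ... | inj₂ (u , refl) | inj₂ (v , refl) =
      proper′ u v (trans (sym (embed-adj u v)) a) ∘ Fin-suc-injective

  -- The apex colour is missing on every embedded vertex, so punching it out keeps the colouring proper.
  apex-colorable⁻ : ∀ {k} → Colorable H (suc k) → Colorable H′ k
  apex-colorable⁻ (c , proper) = (λ u → punchOut (apex≢ u)) , λ u v a →
      proper (embed u) (embed v) (trans (embed-adj u v) a) ∘ punchOut-injective (apex≢ u) (apex≢ v)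
    where
    apex≢ : ∀ u → c apex ≢ c (embed u)
    apex≢ u = proper (embed u) apex (apex-adj u) ∘ sym

  apex-chromatic : ∀ {k} → ChromaticNumber H′ k → ChromaticNumber H (suc k)
  apex-chromatic (colorable , minimal) = apex-colorable colorable , λ where
    zero    _     → ¬colorable-0 H apex
    (suc j) j<1+k → minimal j (s≤s⁻¹ j<1+k) ∘ apex-colorable⁻

  module _ {i} (choosable′ : StrongChromaticChoosable H′ (suc (suc i)))
           (L : ListAssignment n) (isA : IsAssignment L (suc (suc i)))
           (¬col : ¬ LColorable H L) where

    deleteAt : (Fin m → ℕ) → ListAssignment m
    deleteAt e u = delete (e u) (L (embed u))

    -- Colouring the apex with c forces every neighbour to lose c; e picks the colour each list loses.
    deleteAt-constant : ∀ {c} e → c ∈ L apex → (∀ u → e u ∈ L (embed u)) →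
                        (∀ u → c ∈ L (embed u) → e u ≡ c) → Constant (deleteAt e)
    deleteAt-constant {c} e c∈apex e∈ e≡c = proj₂ choosable′ (deleteAt e) isAssignment uncolorable
      where
      isAssignment : IsAssignment (deleteAt e) (suc i)
      isAssignment u = delete-unique (e u) (proj₁ (isA (embed u))) ,
        suc-injective (trans (length-delete (proj₁ (isA (embed u))) (e∈ u)) (proj₂ (isA (embed u))))
      c∉ : ∀ u → c ∉ deleteAt e u
      c∉ u c∈ with c ∈? L (embed u)
      ... | yes c∈L = ∉-delete c (L (embed u)) (subst (λ d → c ∈ delete d (L (embed u))) (e≡c u c∈L) c∈)
      ... | no c∉L  = c∉L (∈-delete⁻ (L (embed u)) c∈)
      uncolorable : ¬ LColorable H′ (deleteAt e)
      uncolorable (f′ , f′∈ , proper′) = ¬col (f , f∈ , proper)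
        where
        f : Fin n → ℕ
        f x with cover x
        ... | inj₁ _       = c
        ... | inj₂ (u , _) = f′ u
        f∈ : ∀ x → f x ∈ L x
        f∈ x with cover x
        ... | inj₁ refl       = c∈apex
        ... | inj₂ (u , refl) = ∈-delete⁻ (L (embed u)) (f′∈ u)
        proper : ∀ x y → adj H x y ≡ true → f x ≢ f y
        proper x y a with cover x | cover y
        ... | inj₁ refl       | inj₁ refl       = contradiction refl (adj-irrefl H a)
        ... | inj₁ refl       | inj₂ (v , refl) = λ c≡ → c∉ v (subst (_∈ _) (sym c≡) (f′∈ v))
        ... | inj₂ (u , refl) | inj₁ refl       = λ ≡c → c∉ u (subst (_∈ _) ≡c (f′∈ u))
        ... | inj₂ (u , refl) | inj₂ (v , refl) = proper′ u v (trans (sym (embed-adj u v)) a)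

    other-vertex : ∀ u₀ → ∃ (_≢ u₀)
    other-vertex with chromatic≥2⇒edge H′ (s≤s (s≤s z≤n)) (proj₁ choosable′)
    ... | _ , _ , a = other-than (adj-irrefl H′ a)

    choice : ℕ → Fin m → ℕ → Fin m → ℕ
    choice c u₀ t u with c ∈? L (embed u) | u Fin.≟ u₀
    ... | yes _ | _     = c
    ... | no _  | yes _ = t
    ... | no _  | no _  = proj₁ (∈-nonempty (L (embed u)) (proj₂ (isA (embed u))))

    choice-∈ : ∀ c u₀ {t} → t ∈ L (embed u₀) → ∀ u → choice c u₀ t u ∈ L (embed u)
    choice-∈ c u₀ t∈ u with c ∈? L (embed u) | u Fin.≟ u₀
    ... | yes c∈ | _        = c∈
    ... | no _   | yes refl = t∈
    ... | no _   | no _     = proj₂ (∈-nonempty (L (embed u)) (proj₂ (isA (embed u))))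

    choice-≡ : ∀ c u₀ t u → c ∈ L (embed u) → choice c u₀ t u ≡ c
    choice-≡ c u₀ t u c∈ with c ∈? L (embed u)
    ... | yes _  = refl
    ... | no c∉ = contradiction c∈ c∉

    choice-at : ∀ c u₀ t → c ∉ L (embed u₀) → choice c u₀ t u₀ ≡ t
    choice-at c u₀ t c∉ with c ∈? L (embed u₀) | u₀ Fin.≟ u₀
    ... | yes c∈ | _       = contradiction c∈ c∉
    ... | no _   | yes _   = refl
    ... | no _   | no u₀≢u₀ = contradiction refl u₀≢u₀

    choice-away : ∀ c u₀ s t u → u ≢ u₀ → choice c u₀ s u ≡ choice c u₀ t u
    choice-away c u₀ s t u u≢u₀ with c ∈? L (embed u) | u Fin.≟ u₀
    ... | yes _ | _        = refl
    ... | no _  | yes u≡u₀ = contradiction u≡u₀ u≢u₀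
    ... | no _  | no _     = refl

    -- If c ∉ L u₀, losing a or b at u₀ gives two constant assignments that agree on another vertex v₀,
    -- so b would survive its own deletion.
    apex-list-⊆ : ∀ {c} → c ∈ L apex → ∀ u₀ → c ∈ L (embed u₀)
    apex-list-⊆ {c} c∈apex u₀ with c ∈? L (embed u₀)
    ... | yes c∈ = c∈
    ... | no c∉ with two-distinct (proj₁ (isA (embed u₀))) (proj₂ (isA (embed u₀))) | other-vertex u₀
    ...   | a , b , a∈ , b∈ , a≢b | v₀ , v₀≢u₀ = contradiction b∈-b (∉-delete b (L (embed u₀)))
      where
      reduced : ℕ → ListAssignment m
      reduced t = deleteAt (choice c u₀ t)
      reduced-constant : ∀ {t} → t ∈ L (embed u₀) → Constant (reduced t)
      reduced-constant t∈ = deleteAt-constant _ c∈apex (choice-∈ c u₀ t∈) (choice-≡ c u₀ _)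
      b∈reduced-a-at-u₀ : b ∈ reduced a u₀
      b∈reduced-a-at-u₀ = subst (λ d → b ∈ delete d (L (embed u₀))) (sym (choice-at c u₀ a c∉))
                                (∈-delete⁺ b∈ a≢b)
      b∈reduced-b-at-v₀ : b ∈ reduced b v₀
      b∈reduced-b-at-v₀ = subst (λ d → b ∈ delete d (L (embed v₀))) (choice-away c u₀ a b v₀ v₀≢u₀)
                                (Equivalence.to (reduced-constant a∈ u₀ v₀ b) b∈reduced-a-at-u₀)
      b∈-b : b ∈ delete b (L (embed u₀))
      b∈-b = subst (λ d → b ∈ delete d (L (embed u₀))) (choice-at c u₀ b c∉)
                   (Equivalence.to (reduced-constant b∈ v₀ u₀ b) b∈reduced-b-at-v₀)

    ∈-apex⇔ : ∀ x c → c ∈ L x ⇔ c ∈ L apex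
    ∈-apex⇔ x c with cover x
    ... | inj₁ refl       = ⇔.refl
    ... | inj₂ (u , refl) = mk⇔ (⊆∧length≤⇒⊇ (unique apex) (unique (embed u)) apex⊆u sameLength) apex⊆u
      where
      unique : ∀ x → Unique (L x)
      unique x = proj₁ (isA x)
      apex⊆u : L apex ⊆ L (embed u)
      apex⊆u c∈ = apex-list-⊆ c∈ u
      sameLength : length (L (embed u)) ≤ length (L apex)
      sameLength = ≤-reflexive (trans (proj₂ (isA (embed u))) (sym (proj₂ (isA apex))))

    apex-constant : Constant L
    apex-constant x y c = ⇔.trans (∈-apex⇔ x c) (⇔.sym (∈-apex⇔ y c))

  apex-strongChromaticChoosable : ∀ {i} → StrongChromaticChoosable H′ (suc (suc i)) →
                                  StrongChromaticChoosable H (suc (suc (suc i)))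
  apex-strongChromaticChoosable choosable′ = apex-chromatic (proj₁ choosable′) , apex-constant choosable′

module _ {n} (G : Graph n) (p : ℕ) where

  ∨K-adj-↑ˡ↑ˡ : ∀ i j → adj (G ∨K p) (i ↑ˡ p) (j ↑ˡ p) ≡ adj G i j
  ∨K-adj-↑ˡ↑ˡ i j rewrite splitAt-↑ˡ n i p | splitAt-↑ˡ n j p = refl

  ∨K-adj-↑ˡ↑ʳ : ∀ i j → adj (G ∨K p) (i ↑ˡ p) (n ↑ʳ j) ≡ true
  ∨K-adj-↑ˡ↑ʳ i j rewrite splitAt-↑ˡ n i p | splitAt-↑ʳ n p j = refl

  ∨K-adj-↑ʳ↑ˡ : ∀ i j → adj (G ∨K p) (n ↑ʳ i) (j ↑ˡ p) ≡ true
  ∨K-adj-↑ʳ↑ˡ i j rewrite splitAt-↑ʳ n p i | splitAt-↑ˡ n j p = refl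

  ∨K-adj-↑ʳ↑ʳ : ∀ i j → adj (G ∨K p) (n ↑ʳ i) (n ↑ʳ j) ≡ not (does (i Fin.≟ j))
  ∨K-adj-↑ʳ↑ʳ i j rewrite splitAt-↑ʳ n p i | splitAt-↑ʳ n p j = refl

module _ {n} (G : Graph n) where

  ∨K1-apexExtension : ApexExtension G (G ∨K 1)
  ∨K1-apexExtension = record
    { embed     = _↑ˡ 1
    ; apex      = n ↑ʳ zero
    ; embed-adj = ∨K-adj-↑ˡ↑ˡ G 1
    ; apex-adj  = λ u → ∨K-adj-↑ˡ↑ʳ G 1 u zero
    ; cover     = cover
    }
    where
    cover : ∀ x → x ≡ n ↑ʳ zero ⊎ ∃ λ u → u ↑ˡ 1 ≡ x
    cover x with splitAt n x | join-splitAt n 1 x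
    ... | inj₁ i    | i≡x = inj₂ (i , i≡x)
    ... | inj₂ zero | w≡x = inj₁ (sym w≡x)

  -- The new clique vertex is the first one, so K_p sits in K_{p+1} shifted by one.
  ∨K-suc-apexExtension : ∀ p → ApexExtension (G ∨K p) (G ∨K suc p)
  ∨K-suc-apexExtension p = record
    { embed     = embed
    ; apex      = n ↑ʳ zero
    ; embed-adj = embed-adj
    ; apex-adj  = apex-adj
    ; cover     = cover
    }
    where
    embed : Fin (n + p) → Fin (n + suc p)
    embed x with splitAt n x
    ... | inj₁ i = i ↑ˡ suc p
    ... | inj₂ j = n ↑ʳ suc j
    embed-adj : ∀ u v → adj (G ∨K suc p) (embed u) (embed v) ≡ adj (G ∨K p) u v
    embed-adj u v with splitAt n u | splitAt n v
    ... | inj₁ i | inj₁ j = ∨K-adj-↑ˡ↑ˡ G (suc p) i j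
    ... | inj₁ i | inj₂ j = ∨K-adj-↑ˡ↑ʳ G (suc p) i (suc j)
    ... | inj₂ i | inj₁ j = ∨K-adj-↑ʳ↑ˡ G (suc p) (suc i) j
    ... | inj₂ i | inj₂ j = ∨K-adj-↑ʳ↑ʳ G (suc p) (suc i) (suc j)
    apex-adj : ∀ u → adj (G ∨K suc p) (embed u) (n ↑ʳ zero) ≡ true
    apex-adj u with splitAt n u
    ... | inj₁ i = ∨K-adj-↑ˡ↑ʳ G (suc p) i zero
    ... | inj₂ j = ∨K-adj-↑ʳ↑ʳ G (suc p) (suc j) zero
    embed-↑ˡ : ∀ i → embed (i ↑ˡ p) ≡ i ↑ˡ suc p
    embed-↑ˡ i rewrite splitAt-↑ˡ n i p = refl
    embed-↑ʳ : ∀ j → embed (n ↑ʳ j) ≡ n ↑ʳ suc j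
    embed-↑ʳ j rewrite splitAt-↑ʳ n p j = refl
    cover : ∀ x → x ≡ n ↑ʳ zero ⊎ ∃ λ u → embed u ≡ x
    cover x with splitAt n x | join-splitAt n (suc p) x
    ... | inj₁ i       | i≡x = inj₂ (i ↑ˡ p , trans (embed-↑ˡ i) i≡x)
    ... | inj₂ zero    | w≡x = inj₁ (sym w≡x)
    ... | inj₂ (suc j) | j≡x = inj₂ (n ↑ʳ j , trans (embed-↑ʳ j) j≡x)

  ∨K-strongChromaticChoosable : ∀ {i} → StrongChromaticChoosable G (2 + i) →
                                ∀ p → StrongChromaticChoosable (G ∨K suc p) (2 + i + suc p)
  ∨K-strongChromaticChoosable {i} choosable zero =
    subst (StrongChromaticChoosable (G ∨K 1)) (+-comm 1 (2 + i))
      (apex-strongChromaticChoosable ∨K1-apexExtension choosable)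
  ∨K-strongChromaticChoosable {i} choosable (suc p) =
    subst (StrongChromaticChoosable (G ∨K suc (suc p))) (cong (2 +_) (sym (+-suc i (suc p))))
      (apex-strongChromaticChoosable (∨K-suc-apexExtension (suc p))
        (∨K-strongChromaticChoosable choosable p))

listSum-allFin : ∀ {n} (f : Fin n → ℕ) → List.sum (map f (allFin n)) ≡ ∑[ i < n ] f i
listSum-allFin {n} f = trans (cong List.sum (map-tabulate (λ i → i) f)) (sum-tabulate n f)
  where
  sum-tabulate : ∀ n (f : Fin n → ℕ) → List.sum (tabulate f) ≡ sum f
  sum-tabulate zero    f = refl
  sum-tabulate (suc n) f = cong (f zero +_) (sum-tabulate n (f ∘ suc))

∑-↑ : ∀ m {n} (f : Fin (m + n) → ℕ) → ∑[ x < m + n ] f x ≡ ∑[ i < m ] f (i ↑ˡ n) + ∑[ j < n ] f (m ↑ʳ j)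
∑-↑ zero    f = refl
∑-↑ (suc m) f = trans (cong (f zero +_) (∑-↑ m (f ∘ suc))) (sym (+-assoc (f zero) _ _))

∑-const : ∀ n c → ∑[ i < n ] c ≡ n * c
∑-const zero    c = refl
∑-const (suc n) c = cong (c +_) (∑-const n c)

<ᵇ-irrefl : ∀ m → (m <ᵇ m) ≡ false
<ᵇ-irrefl zero    = refl
<ᵇ-irrefl (suc m) = <ᵇ-irrefl m

toℕ<ᵇ+ : ∀ {n} (i : Fin n) m → (toℕ i <ᵇ n + m) ≡ true
toℕ<ᵇ+ zero    m = refl
toℕ<ᵇ+ (suc i) m = toℕ<ᵇ+ i m

+<ᵇtoℕ : ∀ {n} m (j : Fin n) → (n + m <ᵇ toℕ j) ≡ false
+<ᵇtoℕ m zero    = refl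
+<ᵇtoℕ m (suc j) = +<ᵇtoℕ m j

+-<ᵇ-cancelˡ : ∀ n a b → (n + a <ᵇ n + b) ≡ (a <ᵇ b)
+-<ᵇ-cancelˡ zero    a b = refl
+-<ᵇ-cancelˡ (suc n) a b = +-<ᵇ-cancelˡ n a b

edgeIndicator : ∀ {n} → Graph n → Fin n → Fin n → ℕ
edgeIndicator G i j = if (toℕ i <ᵇ toℕ j) ∧ adj G i j then 1 else 0

pairIndicator : ∀ {p} → Fin p → Fin p → ℕ
pairIndicator i j = if toℕ i <ᵇ toℕ j then 1 else 0

edgeCount-∑ : ∀ {n} (G : Graph n) → edgeCount G ≡ ∑[ i < n ] ∑[ j < n ] edgeIndicator G i j
edgeCount-∑ {n} G = trans (listSum-allFin (λ i → List.sum (map (edgeIndicator G i) (allFin n))))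
                          (sum-cong-≗ (λ i → listSum-allFin (edgeIndicator G i)))

∑-pairIndicator : ∀ p → ∑[ i < p ] ∑[ j < p ] pairIndicator i j ≡ p C 2
∑-pairIndicator zero    = refl
∑-pairIndicator (suc p) = begin
  ∑[ j < p ] 1 + ∑[ i < p ] ∑[ j < p ] pairIndicator i j ≡⟨ cong₂ _+_ (trans (∑-const p 1) (*-identityʳ p)) (∑-pairIndicator p) ⟩
  p + p C 2                                              ≡⟨ cong (_+ p C 2) (sym (nC1≡n p)) ⟩
  p C 1 + p C 2                                          ≡⟨ nCk+nC[k+1]≡[n+1]C[k+1] p 1 ⟩
  suc p C 2                                              ∎
  where open ≡-Reasoning

module _ {n} (G : Graph n) (p : ℕ) where

  private
    I = edgeIndicator (G ∨K p)

  ∑-edgeIndicator-↑ˡ : ∀ i → ∑[ y < n + p ] I (i ↑ˡ p) y ≡ ∑[ j < n ] edgeIndicator G i j + p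
  ∑-edgeIndicator-↑ˡ i = begin
    ∑[ y < n + p ] I (i ↑ˡ p) y                                      ≡⟨ ∑-↑ n (I (i ↑ˡ p)) ⟩
    ∑[ j < n ] I (i ↑ˡ p) (j ↑ˡ p) + ∑[ j < p ] I (i ↑ˡ p) (n ↑ʳ j) ≡⟨ cong₂ _+_ (sum-cong-≗ toG) (sum-cong-≗ toK) ⟩
    ∑[ j < n ] edgeIndicator G i j + ∑[ j < p ] 1                    ≡⟨ cong (_ +_) (trans (∑-const p 1) (*-identityʳ p)) ⟩
    ∑[ j < n ] edgeIndicator G i j + p                               ∎
    where
    open ≡-Reasoning
    toG : ∀ j → I (i ↑ˡ p) (j ↑ˡ p) ≡ edgeIndicator G i j
    toG j rewrite toℕ-↑ˡ i p | toℕ-↑ˡ j p | ∨K-adj-↑ˡ↑ˡ G p i j = refl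
    toK : ∀ j → I (i ↑ˡ p) (n ↑ʳ j) ≡ 1
    toK j rewrite toℕ-↑ˡ i p | toℕ-↑ʳ n j | ∨K-adj-↑ˡ↑ʳ G p i j | toℕ<ᵇ+ i (toℕ j) = refl

  ∑-edgeIndicator-↑ʳ : ∀ i → ∑[ y < n + p ] I (n ↑ʳ i) y ≡ ∑[ j < p ] pairIndicator i j
  ∑-edgeIndicator-↑ʳ i = begin
    ∑[ y < n + p ] I (n ↑ʳ i) y                                      ≡⟨ ∑-↑ n (I (n ↑ʳ i)) ⟩
    ∑[ j < n ] I (n ↑ʳ i) (j ↑ˡ p) + ∑[ j < p ] I (n ↑ʳ i) (n ↑ʳ j) ≡⟨ cong₂ _+_ (sum-cong-≗ toG) (sum-cong-≗ toK) ⟩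
    ∑[ j < n ] 0 + ∑[ j < p ] pairIndicator i j                      ≡⟨ cong (_+ _) (trans (∑-const n 0) (*-zeroʳ n)) ⟩
    ∑[ j < p ] pairIndicator i j                                     ∎
    where
    open ≡-Reasoning
    toG : ∀ j → I (n ↑ʳ i) (j ↑ˡ p) ≡ 0
    toG j rewrite toℕ-↑ˡ j p | toℕ-↑ʳ n i | +<ᵇtoℕ (toℕ i) j = refl
    toK : ∀ j → I (n ↑ʳ i) (n ↑ʳ j) ≡ pairIndicator i j
    toK j rewrite toℕ-↑ʳ n i | toℕ-↑ʳ n j | ∨K-adj-↑ʳ↑ʳ G p i j | +-<ᵇ-cancelˡ n (toℕ i) (toℕ j) with i Fin.≟ j
    ... | yes refl rewrite <ᵇ-irrefl (toℕ i) = refl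
    ... | no _     rewrite ∧-identityʳ (toℕ i <ᵇ toℕ j) = refl

  edgeCount-∨K : edgeCount (G ∨K p) ≡ edgeCount G + n * p + p C 2
  edgeCount-∨K = begin
    edgeCount (G ∨K p)                                                  ≡⟨ edgeCount-∑ (G ∨K p) ⟩
    ∑[ x < n + p ] ∑[ y < n + p ] I x y                                 ≡⟨ ∑-↑ n _ ⟩
    ∑[ i < n ] ∑[ y < n + p ] I (i ↑ˡ p) y + ∑[ i < p ] ∑[ y < n + p ] I (n ↑ʳ i) y
      ≡⟨ cong₂ _+_ (sum-cong-≗ ∑-edgeIndicator-↑ˡ) (sum-cong-≗ ∑-edgeIndicator-↑ʳ) ⟩
    ∑[ i < n ] (∑[ j < n ] edgeIndicator G i j + p) + ∑[ i < p ] ∑[ j < p ] pairIndicator i j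
      ≡⟨ cong₂ _+_ (∑-distrib-+ (λ i → ∑[ j < n ] edgeIndicator G i j) (λ _ → p)) (∑-pairIndicator p) ⟩
    ∑[ i < n ] ∑[ j < n ] edgeIndicator G i j + ∑[ i < n ] p + p C 2
      ≡⟨ cong (_+ p C 2) (cong₂ _+_ (sym (edgeCount-∑ G)) (∑-const n p)) ⟩
    edgeCount G + n * p + p C 2                                         ∎
    where open ≡-Reasoning

2*[nC2]+n≡n*n : ∀ n → 2 * (n C 2) + n ≡ n * n
2*[nC2]+n≡n*n zero    = refl
2*[nC2]+n≡n*n (suc n) = begin
  2 * (suc n C 2) + suc n       ≡⟨ cong (λ c → 2 * c + suc n) (sym (nCk+nC[k+1]≡[n+1]C[k+1] n 1)) ⟩
  2 * (n C 1 + n C 2) + suc n   ≡⟨ cong (λ c → 2 * (c + n C 2) + suc n) (nC1≡n n) ⟩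
  2 * (n + n C 2) + suc n       ≡⟨ regroup n (n C 2) ⟩
  2 * (n C 2) + n + (n + suc n) ≡⟨ cong (_+ (n + suc n)) (2*[nC2]+n≡n*n n) ⟩
  n * n + (n + suc n)           ≡⟨ square-suc n ⟩
  suc n * suc n                 ∎
  where
  open ≡-Reasoning
  regroup : ∀ n c → 2 * (n + c) + suc n ≡ 2 * c + n + (n + suc n)
  regroup = solve-∀
  square-suc : ∀ n → n * n + (n + suc n) ≡ suc n * suc n
  square-suc = solve-∀

-- The inequality is doubled and shifted by p, so that d ≤ p(2k+p−3)/2 and 2·C(p,2) + p = p² enter without division.
∨K-edgeCount-bound : ∀ {n k p e c} → 2 ≤ k → n * (k ∸ 2) ≤ e →
                     2 * (e ∸ n * (k ∸ 2)) ≤ p * (2 * k + p ∸ 3) → 2 * c + p ≡ p * p →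
                     e + n * p + c ≤ (n + p) * (k + p ∸ 2)
∨K-edgeCount-bound {n} {suc (suc k)} {p} {e} {c} _ nk≤e d≤ 2c+p≡p² =
  *-cancelˡ-≤ 2 (+-cancelʳ-≤ p _ _ (begin
    2 * (e + n * p + c) + p                            ≡⟨ cong (λ x → 2 * (x + n * p + c) + p) (sym (m∸n+n≡m nk≤e)) ⟩
    2 * (d + n * k + n * p + c) + p                    ≡⟨ expand d (n * k) (n * p) c p ⟩
    2 * d + (2 * (n * k) + 2 * (n * p) + (2 * c + p))  ≡⟨ cong (λ x → 2 * d + (2 * (n * k) + 2 * (n * p) + x)) 2c+p≡p² ⟩
    2 * d + (2 * (n * k) + 2 * (n * p) + p * p)        ≤⟨ +-monoˡ-≤ _ d≤ ⟩
    p * (2 * suc (suc k) + p ∸ 3) + (2 * (n * k) + 2 * (n * p) + p * p)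
      ≡⟨ cong (λ x → p * x + (2 * (n * k) + 2 * (n * p) + p * p)) (trans (cong (_∸ 3) (shift k p)) (m+n∸n≡m _ 3)) ⟩
    p * (2 * k + p + 1) + (2 * (n * k) + 2 * (n * p) + p * p) ≡⟨ collect n k p ⟩
    2 * ((n + p) * (k + p)) + p                        ∎))
  where
  open Data.Nat.Properties.≤-Reasoning
  d = e ∸ n * k
  expand : ∀ d a b c p → 2 * (d + a + b + c) + p ≡ 2 * d + (2 * a + 2 * b + (2 * c + p))
  expand = solve-∀
  shift : ∀ k p → 2 * suc (suc k) + p ≡ 2 * k + p + 1 + 3
  shift = solve-∀
  collect : ∀ n k p → p * (2 * k + p + 1) + (2 * (n * k) + 2 * (n * p) + p * p) ≡ 2 * ((n + p) * (k + p)) + p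
  collect = solve-∀
∨K-edgeCount-bound {k = 1} (s≤s ())

proposition3p7 : (k n : ℕ) (G : Graph n) (p : ℕ) →
    2 ≤ k →
    StrongChromaticChoosable G k →
    n * (k ∸ 2) < edgeCount G →
    1 ≤ p →
    2 * (edgeCount G ∸ n * (k ∸ 2)) ≤ p * (2 * k + p ∸ 3) →
    StrongChromaticChoosable (G ∨K p) (k + p) ×
    edgeCount (G ∨K p) ≤ (n + p) * (k + p ∸ 2)
proposition3p7 (suc (suc i)) n G (suc p) 2≤k choosable d>0 _ d≤ =
  ∨K-strongChromaticChoosable G choosable p ,
  subst (_≤ (n + suc p) * (i + suc p)) (sym (edgeCount-∨K G (suc p)))
    (∨K-edgeCount-bound {n} 2≤k (<⇒≤ d>0) d≤ (2*[nC2]+n≡n*n (suc p)))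
proposition3p7 (suc zero) _ _ _ (s≤s ()) _ _ _ _
proposition3p7 (suc (suc _)) _ _ zero _ _ _ () _
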